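{- Let $v_1,\dots,v_n$ be distinct positive integers and fix $i\in\{1,\dots,n\}$. Then there exist infinitely many positive integers $w$ such that $v_iw+1$ is a perfect square, $v_jw+1$ is not a perfect square for every $j\in\{1,\dots,n\}$ with $j\neq i$, and the square-free part of $w$ is different from the square-free part of $v_\ell$ for every $\ell=1,\dots,n$.
   Context: The square-free part of a positive integer $v$ is the unique square-free positive integer $s$ such that $v=sm^2$ for some positive integer $m$. -}

module Defs where

open import Data.Nat using (ℕ; _*_; _≥_)
open import Data.Nat.Divisibility using (_∣_)
open import Data.Product using (Σ; _×_)
open import Relation.Binary.PropositionalEquality using (_≡_)

IsSquare : ℕ → Set
IsSquare n = Σ ℕ λ k → n ≡ k * k

SquareFree : ℕ → Set
SquareFree s = (d : ℕ) → d * d ∣ s → d ≡ 1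

IsSquareFreePart : ℕ → ℕ → Set
IsSquareFreePart v s = SquareFree s × s ≥ 1 × Σ ℕ λ m → m ≥ 1 × v ≡ s * (m * m)

{-# OPTIONS --safe #-}

-- Put a = v i and w = t (a t + 2), so that a w + 1 = (a t + 1)² for every t.  If v j w + c is a
-- square y², then u = a t + 1 solves a y² + v j = v j u² + c a.  Two solutions u < u + d of such
-- an equation cross-multiply to a (P² - Q²) = (c a - v j) ((u + d)² - u²) with P ≠ Q, and since
-- 2 a (P + Q) ≥ 2 u (u + d) this forces u ≤ 2 (v j + c a) d: the solutions are sparse.  Hence
-- among 2n + 1 consecutive large values of t, each condition "v j w + c is a square"
-- (c ∈ {0, 1}, (j , c) ≠ (i , 1)) holds for at most one, and by pigeonhole some t satisfies none
-- of them.  That w works, because a common square-free part of w and v l would make v l w a square.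

module Submission where

open import Defs
open import Data.Nat using (ℕ; suc; _+_; _*_; _<_; _≥_)
open import Data.Fin using (Fin)
open import Data.Product using (Σ; _×_)
open import Relation.Binary.PropositionalEquality using (_≡_; _≢_)
open import Relation.Nullary using (¬_)
open import Function.Definitions using (Injective)

open import Data.Nat using (zero; _≤_; _≟_; z≤n; s≤s; NonZero; >-nonZero; >-nonZero⁻¹; ≢-nonZero⁻¹)
open import Data.Nat.Properties
open import Data.Nat.Tactic.RingSolver using (solve; solve-∀)
open import Data.Fin using (zero; suc; toℕ; fromℕ<; combine; remQuot)
open import Data.Fin.Properties using (any?; all?; ¬∀⟶∃¬; pigeonhole; toℕ<n; toℕ-fromℕ<; remQuot-combine)
open import Data.List using ([]; _∷_; tabulate)
open import Data.List.Extrema.Nat using (max; xs≤max)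
open import Data.List.Relation.Unary.All.Properties using (tabulate⁻)
open import Data.Product using (_,_; ∃; proj₁; map₂)
open import Data.Empty using (⊥; ⊥-elim)
open import Function using (_∘_)
open import Relation.Binary.PropositionalEquality using (refl; sym; trans; cong; subst; module ≡-Reasoning)
open import Relation.Binary.Definitions using (tri<; tri≈; tri>)
open import Relation.Nullary using (Dec; yes; no; map′; ¬?; contradiction)
open import Relation.Nullary.Decidable using (_×-dec_; decidable-stable)

n≤n*n : ∀ n → n ≤ n * n
n≤n*n zero    = z≤n
n≤n*n (suc n) = m≤m*n (suc n) (suc n)

square-cancel-≤ : ∀ {m n} → m * m ≤ n * n → m ≤ n
square-cancel-≤ m²≤n² = ≮⇒≥ λ n<m → <⇒≱ (*-mono-< n<m n<m) m²≤n²

square-gap : ∀ {P Q} → P < Q → P * P + (P + Q) ≤ Q * Q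
square-gap {P} {Q} P<Q = begin
  P * P + (P + Q) ≡⟨ solve (P ∷ Q ∷ []) ⟩
  P * suc P + Q   ≤⟨ +-monoˡ-≤ Q (*-monoʳ-≤ P P<Q) ⟩
  P * Q + Q       ≡⟨ +-comm (P * Q) Q ⟩
  suc P * Q       ≤⟨ *-monoˡ-≤ Q P<Q ⟩
  Q * Q           ∎
  where open ≤-Reasoning

isSquare? : ∀ n → Dec (IsSquare n)
isSquare? n = map′ (λ (k , n≡k²) → toℕ k , n≡k²) root-below (any? λ (k : Fin (suc n)) → n ≟ toℕ k * toℕ k)
  where
  root-below : IsSquare n → ∃ λ (k : Fin (suc n)) → n ≡ toℕ k * toℕ k
  root-below (k , n≡k²) = fromℕ< k<1+n , trans n≡k² (cong (λ x → x * x) (sym (toℕ-fromℕ< k<1+n)))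
    where
    k<1+n : k < suc n
    k<1+n = s≤s (subst (k ≤_) (sym n≡k²) (n≤n*n k))

square-free-part-product : ∀ {v w s} → IsSquareFreePart v s → IsSquareFreePart w s → IsSquare (v * w)
square-free-part-product {s = s} (_ , _ , m , _ , refl) (_ , _ , m′ , _ , refl) =
  s * m * m′ , solve (s ∷ m ∷ m′ ∷ [])

AtMostOnceBelow : ∀ {p} → ℕ → (ℕ → Set p) → Set p
AtMostOnceBelow S P = ∀ {k₁ k₂} → k₁ < k₂ → k₂ < S → P k₁ → P k₂ → ⊥

-- Otherwise picking, for each k < S, a property that k has would be an injection Fin S → Fin m.
∃-avoiding-all : ∀ {m S p} (Bad : Fin m → ℕ → Set p) → (∀ c k → Dec (Bad c k)) → m < S →
                 (∀ c → AtMostOnceBelow S (Bad c)) → ∃ λ k → k < S × ∀ c → ¬ Bad c k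
∃-avoiding-all {m} {S} Bad bad? m<S at-most-once
  with any? (λ (k : Fin S) → all? λ c → ¬? (bad? c (toℕ k)))
... | yes (k , good) = toℕ k , toℕ<n k , good
... | no no-good =
  let k₁ , k₂ , k₁<k₂ , c₁≡c₂ = pigeonhole m<S (proj₁ ∘ witness)
      c₁ , bad₁ = witness k₁
      c₂ , bad₂ = witness k₂
  in ⊥-elim (at-most-once c₁ k₁<k₂ (toℕ<n k₂) bad₁ (subst (λ c → Bad c (toℕ k₂)) (sym c₁≡c₂) bad₂))
  where
  witness : (k : Fin S) → ∃ λ c → Bad c (toℕ k)
  witness k = map₂ (decidable-stable (bad? _ _))
                   (¬∀⟶∃¬ m _ (λ c → ¬? (bad? c (toℕ k))) λ good → no-good (k , good))

record PellSolution (a b e f u : ℕ) : Set where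
  constructor solution
  field
    root     : ℕ
    equation : a * (root * root) + e ≡ b * (u * u) + f

open PellSolution using (root)

square⇒pell-solution : ∀ {a b c w u} → a * w + 1 ≡ u * u → IsSquare (b * w + c) →
                       PellSolution a b b (c * a) u
square⇒pell-solution {a} {b} {c} {w} {u} aw+1≡u² (y , bw+c≡y²) = solution y (begin
  a * (y * y) + b         ≡⟨ cong (λ z → a * z + b) bw+c≡y² ⟨
  a * (b * w + c) + b     ≡⟨ solve (a ∷ b ∷ c ∷ w ∷ []) ⟩
  b * (a * w + 1) + c * a ≡⟨ cong (λ z → b * z + c * a) aw+1≡u² ⟩
  b * (u * u) + c * a     ∎)
  where open ≡-Reasoning

pell-root-bound : ∀ {a b e f u} .{{_ : NonZero b}} → 2 * e ≤ u * u →
                  (s : PellSolution a b e f u) → u ≤ 2 * a * root s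
pell-root-bound {a} {b} {e} {f} {u} 2e≤u² (solution y eq) = square-cancel-≤ (begin
  u * u                       ≤⟨ +-cancelʳ-≤ (u * u) (u * u) (2 * a * (y * y)) twice-bound ⟩
  2 * a * (y * y)             ≤⟨ *-monoˡ-≤ (y * y) (n≤n*n (2 * a)) ⟩
  2 * a * (2 * a) * (y * y)   ≡⟨ solve (a ∷ y ∷ []) ⟩
  2 * a * y * (2 * a * y)     ∎)
  where
  open ≤-Reasoning
  u²≤ay²+e : u * u ≤ a * (y * y) + e
  u²≤ay²+e = begin
    u * u             ≤⟨ m≤n*m (u * u) b ⟩
    b * (u * u)       ≤⟨ m≤m+n (b * (u * u)) f ⟩
    b * (u * u) + f   ≡⟨ eq ⟨
    a * (y * y) + e   ∎
  twice-bound : u * u + u * u ≤ 2 * a * (y * y) + u * u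
  twice-bound = begin
    u * u + u * u             ≡⟨ solve (u ∷ []) ⟩
    2 * (u * u)               ≤⟨ *-monoʳ-≤ 2 u²≤ay²+e ⟩
    2 * (a * (y * y) + e)     ≡⟨ solve (a ∷ y ∷ e ∷ []) ⟩
    2 * a * (y * y) + 2 * e   ≤⟨ +-monoʳ-≤ (2 * a * (y * y)) 2e≤u² ⟩
    2 * a * (y * y) + u * u   ∎

pell-cross-multiply : ∀ {a b e f u} d (s₁ : PellSolution a b e f u) (s₂ : PellSolution a b e f (u + d)) →
  a * ((root s₁ * (u + d)) * (root s₁ * (u + d))) + e * (d * (2 * u + d)) ≡
  a * ((u * root s₂) * (u * root s₂)) + f * (d * (2 * u + d))
pell-cross-multiply {a} {b} {e} {f} {u} d (solution y₁ E₁) (solution y₂ E₂) =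
  +-cancelʳ-≡ ((e + f) * (u * u)) _ _ (begin
  a * ((y₁ * (u + d)) * (y₁ * (u + d))) + e * (d * (2 * u + d)) + (e + f) * (u * u)
    ≡⟨ solve (a ∷ e ∷ f ∷ y₁ ∷ u ∷ d ∷ []) ⟩
  (a * (y₁ * y₁) + e) * ((u + d) * (u + d)) + f * (u * u)
    ≡⟨ cong (λ z → z * ((u + d) * (u + d)) + f * (u * u)) E₁ ⟩
  (b * (u * u) + f) * ((u + d) * (u + d)) + f * (u * u)
    ≡⟨ solve (b ∷ f ∷ u ∷ d ∷ []) ⟩
  (b * ((u + d) * (u + d)) + f) * (u * u) + f * ((u + d) * (u + d))
    ≡⟨ cong (λ z → z * (u * u) + f * ((u + d) * (u + d))) E₂ ⟨
  (a * (y₂ * y₂) + e) * (u * u) + f * ((u + d) * (u + d))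
    ≡⟨ solve (a ∷ e ∷ f ∷ y₂ ∷ u ∷ d ∷ []) ⟩
  a * ((u * y₂) * (u * y₂)) + f * (d * (2 * u + d)) + (e + f) * (u * u) ∎)
  where open ≡-Reasoning

square-difference-bound-< : ∀ a e f D {P Q} → P < Q →
  a * (P * P) + e * D ≡ a * (Q * Q) + f * D → a * (P + Q) ≤ e * D
square-difference-bound-< a e f D {P} {Q} P<Q eq = +-cancelˡ-≤ (a * (P * P)) _ _ (begin
  a * (P * P) + a * (P + Q) ≡⟨ *-distribˡ-+ a (P * P) (P + Q) ⟨
  a * (P * P + (P + Q))     ≤⟨ *-monoʳ-≤ a (square-gap P<Q) ⟩
  a * (Q * Q)               ≤⟨ m≤m+n (a * (Q * Q)) (f * D) ⟩
  a * (Q * Q) + f * D       ≡⟨ eq ⟨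
  a * (P * P) + e * D       ∎)
  where open ≤-Reasoning

square-difference-bound : ∀ a {e f} D P Q .{{_ : NonZero D}} → e ≢ f →
  a * (P * P) + e * D ≡ a * (Q * Q) + f * D → a * (P + Q) ≤ (e + f) * D
square-difference-bound a {e} {f} D P Q e≢f eq with <-cmp P Q
... | tri< P<Q _ _ = ≤-trans (square-difference-bound-< a e f D P<Q eq) (*-monoˡ-≤ D (m≤m+n e f))
... | tri≈ _ refl _ = contradiction (*-cancelʳ-≡ e f D (+-cancelˡ-≡ (a * (P * P)) _ _ eq)) e≢f
... | tri> _ _ Q<P = begin
  a * (P + Q) ≡⟨ cong (a *_) (+-comm P Q) ⟩
  a * (Q + P) ≤⟨ square-difference-bound-< a f e D Q<P (sym eq) ⟩
  f * D       ≤⟨ *-monoˡ-≤ D (m≤n+m f e) ⟩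
  (e + f) * D ∎
  where open ≤-Reasoning

pell-gap : ∀ {a b e f u} d .{{_ : NonZero b}} .{{_ : NonZero d}} → e ≢ f → 2 * e ≤ u * u →
           PellSolution a b e f u → PellSolution a b e f (u + d) → u ≤ 2 * (e + f) * d
pell-gap {a} {b} {e} {f} {u} d e≢f 2e≤u² s₁@(solution y₁ _) s₂@(solution y₂ _) =
  *-cancelʳ-≤ u (2 * (e + f) * d) (u + d) (*-cancelˡ-≤ 2 (begin
    2 * (u * (u + d))                       ≡⟨ solve (u ∷ d ∷ []) ⟩
    u * (u + d) + u * (u + d)               ≤⟨ +-mono-≤ (*-monoˡ-≤ (u + d) (pell-root-bound 2e≤u² s₁))
                                                        (*-monoʳ-≤ u (pell-root-bound 2e≤[u+d]² s₂)) ⟩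
    2 * a * y₁ * (u + d) + u * (2 * a * y₂) ≡⟨ solve (a ∷ y₁ ∷ y₂ ∷ u ∷ d ∷ []) ⟩
    2 * (a * (y₁ * (u + d) + u * y₂))       ≤⟨ *-monoʳ-≤ 2 (square-difference-bound a D (y₁ * (u + d)) (u * y₂) e≢f
                                                                  (pell-cross-multiply d s₁ s₂)) ⟩
    2 * ((e + f) * D)                       ≤⟨ *-monoʳ-≤ 2 (*-monoʳ-≤ (e + f) (*-monoʳ-≤ d 2u+d≤2[u+d])) ⟩
    2 * ((e + f) * (d * (2 * (u + d))))     ≡⟨ solve (e ∷ f ∷ u ∷ d ∷ []) ⟩
    2 * (2 * (e + f) * d * (u + d))         ∎))
  where
  open ≤-Reasoning
  D : ℕ
  D = d * (2 * u + d)
  instance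
    u+d≢0 : NonZero (u + d)
    u+d≢0 = >-nonZero (≤-trans (>-nonZero⁻¹ d) (m≤n+m d u))
    2u+d≢0 : NonZero (2 * u + d)
    2u+d≢0 = >-nonZero (≤-trans (>-nonZero⁻¹ d) (m≤n+m d (2 * u)))
    D≢0 : NonZero D
    D≢0 = m*n≢0 d (2 * u + d)
  2e≤[u+d]² : 2 * e ≤ (u + d) * (u + d)
  2e≤[u+d]² = ≤-trans 2e≤u² (*-mono-≤ (m≤m+n u d) (m≤m+n u d))
  2u+d≤2[u+d] : 2 * u + d ≤ 2 * (u + d)
  2u+d≤2[u+d] = subst (2 * u + d ≤_) (sym (*-distribˡ-+ 2 u d)) (+-monoʳ-≤ (2 * u) (m≤m+n d (d + 0)))

module Candidates {n} (v : Fin n → ℕ) (pos : ∀ j → v j ≥ 1) (i : Fin n) (N : ℕ) where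

  a B m T : ℕ
  a = v i
  B = max 0 (tabulate v)
  m = n * 2
  -- T exceeds 2 v j and the bound 2 (v j + c a) (a m) that pell-gap gives when two u k (k ≤ m) solve one equation
  T = N + 2 * B + 2 * (B + B) * (a * m)

  instance
    a≢0 : NonZero a
    a≢0 = >-nonZero (pos i)

  t u w : ℕ → ℕ
  t k = T + suc k
  u k = a * t k + 1
  w k = t k * (2 + a * t k)

  aw+1≡u² : ∀ k → a * w k + 1 ≡ u k * u k
  aw+1≡u² k = identity a (t k)
    where
    identity : ∀ a t → a * (t * (2 + a * t)) + 1 ≡ (a * t + 1) * (a * t + 1)
    identity = solve-∀

  u-shift : ∀ k o → u (suc k + o) ≡ u k + a * suc o
  u-shift k o = identity a T k o
    where
    identity : ∀ a T k o → a * (T + suc (suc k + o)) + 1 ≡ a * (T + suc k) + 1 + a * suc o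
    identity = solve-∀

  T<t : ∀ k → T < t k
  T<t k = m<m+n T (s≤s z≤n)

  T<u : ∀ k → T < u k
  T<u k = <-≤-trans (T<t k) (≤-trans (m≤n*m (t k) a) (m≤m+n (a * t k) 1))

  T<w : ∀ k → T < w k
  T<w k = <-≤-trans (T<t k) (m≤m*n (t k) (2 + a * t k))

  N<w : ∀ k → N < w k
  N<w k = ≤-<-trans (≤-trans (m≤m+n N (2 * B)) (m≤m+n _ _)) (T<w k)

  v≤B : ∀ j → v j ≤ B
  v≤B = tabulate⁻ (xs≤max 0 (tabulate v))

  c*a≤B : (c : Fin 2) → toℕ c * a ≤ B
  c*a≤B zero       = z≤n
  c*a≤B (suc zero) = ≤-trans (≤-reflexive (*-identityˡ a)) (v≤B i)

  -- The first component rules out (j , c) = (i , 1), for which the square condition always holds.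
  Bad : Fin n × Fin 2 → ℕ → Set
  Bad (j , c) k = v j ≢ toℕ c * a × IsSquare (v j * w k + toℕ c)

  bad? : ∀ jc k → Dec (Bad jc k)
  bad? (j , c) k = ¬? (v j ≟ toℕ c * a) ×-dec isSquare? (v j * w k + toℕ c)

  Bad-at-most-once : ∀ jc → AtMostOnceBelow (suc m) (Bad jc)
  Bad-at-most-once (j , c) {k₁} k₁<k₂ k₂<1+m (v≢ca , sq₁) (_ , sq₂)
    with o , refl ← m≤n⇒∃[o]m+o≡n k₁<k₂ = <⇒≱ (T<u k₁) (begin
      u k₁                                ≤⟨ pell-gap (a * suc o) {{>-nonZero (pos j)}} v≢ca 2v≤u² s₁ s₂ ⟩
      2 * (v j + toℕ c * a) * (a * suc o) ≤⟨ *-mono-≤ (*-monoʳ-≤ 2 (+-mono-≤ (v≤B j) (c*a≤B c)))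
                                                      (*-monoʳ-≤ a 1+o≤m) ⟩
      2 * (B + B) * (a * m)               ≤⟨ m≤n+m _ (N + 2 * B) ⟩
      T                                   ∎)
    where
    open ≤-Reasoning
    s₁ : PellSolution a (v j) (v j) (toℕ c * a) (u k₁)
    s₁ = square⇒pell-solution (aw+1≡u² k₁) sq₁
    s₂ : PellSolution a (v j) (v j) (toℕ c * a) (u k₁ + a * suc o)
    s₂ = subst (PellSolution a (v j) (v j) (toℕ c * a)) (u-shift k₁ o) (square⇒pell-solution (aw+1≡u² _) sq₂)
    2v≤u² : 2 * v j ≤ u k₁ * u k₁
    2v≤u² = ≤-trans (*-monoʳ-≤ 2 (v≤B j)) (≤-trans (≤-trans (m≤n+m (2 * B) N) (m≤m+n _ _))
                    (≤-trans (<⇒≤ (T<u k₁)) (n≤n*n (u k₁))))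
    1+o≤m : suc o ≤ m
    1+o≤m = ≤-trans (s≤s (m≤n+m o k₁)) (≤-pred k₂<1+m)
    instance
      a[1+o]≢0 : NonZero (a * suc o)
      a[1+o]≢0 = m*n≢0 a (suc o)

  good-candidate : ∃ λ k → ∀ j c → ¬ Bad (j , c) k
  good-candidate with k , _ , good ← ∃-avoiding-all (λ x → Bad (remQuot 2 x)) (λ x → bad? (remQuot 2 x))
                                       (n<1+n m) (λ x → Bad-at-most-once (remQuot 2 x))
    = k , λ j c → subst (λ jc → ¬ Bad jc k) (remQuot-combine j c) (good (combine j c))

lemma2 : (n : ℕ) (v : Fin n → ℕ) → (∀ j → v j ≥ 1) → Injective _≡_ _≡_ v →
         (i : Fin n) → (N : ℕ) →
         Σ ℕ λ w → N < w × w ≥ 1 ×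
           IsSquare (v i * w + 1) ×
           (∀ j → j ≢ i → ¬ IsSquare (v j * w + 1)) ×
           (∀ l s t → IsSquareFreePart w s → IsSquareFreePart (v l) t → s ≢ t)
lemma2 n v pos inj i N =
  let k , good = good-candidate in
    w k
  , N<w k
  , ≤-<-trans z≤n (T<w k)
  , (u k , aw+1≡u² k)
  , (λ j j≢i sq → good j (suc zero) (v≢v[i] j≢i , sq))
  , λ l s t sqf-w sqf-vl s≡t → good l zero (v≢0 l , subst IsSquare (sym (+-identityʳ _))
      (square-free-part-product sqf-vl (subst (IsSquareFreePart _) s≡t sqf-w)))
  where
  open Candidates v pos i N
  v≢v[i] : ∀ {j} → j ≢ i → v j ≢ 1 * v i
  v≢v[i] j≢i vj≡1*vi = j≢i (inj (trans vj≡1*vi (*-identityˡ (v i))))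
  v≢0 : ∀ l → v l ≢ 0
  v≢0 l = ≢-nonZero⁻¹ (v l) {{>-nonZero (pos l)}}
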